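{- Every spider is neighborhood-prime.
   Context: A neighborhood-prime labeling of a simple graph $G$ with $N$ vertices is a bijection $f:V(G)\to\{1,\ldots,N\}$ such that for every vertex $v$ with $\deg(v)>1$, $\gcd\{f(u):u\in N(v)\}=1$, where $N(v)$ is the neighborhood of $v$; a graph admitting one is neighborhood-prime. A spider is a tree with exactly one vertex of degree $3$ or more; equivalently, a collection of paths $P_{n_1},\ldots,P_{n_k}$ ($k\ge 3$) each having one endpoint joined by an edge to a common central vertex. -}

module Defs where

open import Data.Nat using (ℕ; zero; suc; _≤_; _<_)
open import Data.Nat.Divisibility using (_∣_)
open import Data.Fin using (Fin; zero; suc; toℕ)
open import Data.List using (tabulate)
open import Data.Nat.ListAction using (sum)
open import Data.Product using (Σ; ∃; _×_)
open import Relation.Binary.PropositionalEquality using (_≡_; _≢_)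
open import Function.Bundles using (_⤖_; Bijection)

-- A (finite simple) graph given by a vertex type and an adjacency relation.
-- The number of vertices N enters through the bijection V ⤖ Fin N.
label : ∀ {V : Set} {N : ℕ} → V ⤖ Fin N → V → ℕ
label f v = suc (toℕ (Bijection.to f v))

DegGt1 : {V : Set} → (V → V → Set) → V → Set
DegGt1 {V} Adj v = Σ V λ u → Σ V λ w → u ≢ w × Adj v u × Adj v w

-- gcd {f(u) : u ∈ N(v)} = 1 : the only common divisor of the labels of
-- the neighbours of v is 1 (labels are positive, the neighbourhood finite).
NbhdGcdOne : {V : Set} {N : ℕ} → (V → V → Set) → V ⤖ Fin N → V → Set
NbhdGcdOne {V} Adj f v = ∀ d → (∀ u → Adj v u → d ∣ label f u) → d ≡ 1

NeighborhoodPrimeLabeling : {V : Set} (N : ℕ) → (V → V → Set) → V ⤖ Fin N → Set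
NeighborhoodPrimeLabeling {V} N Adj f = ∀ v → DegGt1 Adj v → NbhdGcdOne Adj f v

NeighborhoodPrime : (V : Set) (N : ℕ) → (V → V → Set) → Set
NeighborhoodPrime V N Adj = Σ (V ⤖ Fin N) λ f → NeighborhoodPrimeLabeling N Adj f

data SpiderV (k : ℕ) (len : Fin k → ℕ) : Set where
  centre : SpiderV k len
  node   : (i : Fin k) → Fin (len i) → SpiderV k len

data SpiderAdj (k : ℕ) (len : Fin k → ℕ) : SpiderV k len → SpiderV k len → Set where
  c→l  : ∀ i (j : Fin (len i)) → toℕ j ≡ 0 → SpiderAdj k len centre (node i j)
  l→c  : ∀ i (j : Fin (len i)) → toℕ j ≡ 0 → SpiderAdj k len (node i j) centre
  next : ∀ i (j j' : Fin (len i)) → toℕ j' ≡ suc (toℕ j) → SpiderAdj k len (node i j) (node i j')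
  prev : ∀ i (j j' : Fin (len i)) → toℕ j ≡ suc (toℕ j') → SpiderAdj k len (node i j) (node i j')

spiderSize : (k : ℕ) → (Fin k → ℕ) → ℕ
spiderSize k len = suc (sum (tabulate len))

-- Label the centre 1 and give each leg a block of consecutive labels, the blocks
-- following each other in leg order.  Inside a leg the labels are assigned by a
-- "fold" of the path, under which any two vertices at distance two get consecutive
-- labels, so every inner vertex of a leg sees two coprime labels.  A vertex next to
-- the centre sees the label 1.  Leg 0 is folded in reverse, so that its first vertex
-- carries the last label of its block and the first vertex of leg 1 the next label:
-- the centre then sees two consecutive labels as well.
module Submission where

open import Defs
open import Data.Nat using (ℕ; zero; suc; _+_; _∸_; _≤_; _≟_; s≤s)
open import Data.Nat.Properties
  using (suc-injective; +-suc; +-comm; +-identityʳ; +-∸-assoc; +-assoc; m+[n∸m]≡n)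
open import Data.Nat.Divisibility using (_∣_; ∣1⇒≡1; ∣m+n∣m⇒∣n)
open import Data.Nat.Coprimality using (Coprime)
import Data.Nat.Coprimality as Coprime
open import Data.Fin
  using (Fin; zero; suc; toℕ; fromℕ; fromℕ<; inject₁; opposite; _↑ˡ_; _↑ʳ_; splitAt)
open import Data.Fin.Properties
  using ( toℕ-injective; toℕ-fromℕ<; toℕ-inject₁; toℕ<n; toℕ-↑ˡ; toℕ-↑ʳ; opposite-prop
        ; opposite-involutive; splitAt-↑ˡ; splitAt-↑ʳ; splitAt⁻¹-↑ˡ; splitAt⁻¹-↑ʳ)
open import Data.Fin.Relation.Unary.Top using (view; ‵fromℕ; ‵inj₁; view-fromℕ; view-inject₁)
open import Data.List using (tabulate)
open import Data.Nat.ListAction using (sum)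
open import Data.Product using (Σ; _,_; map)
open import Data.Sum using (_⊎_; inj₁; inj₂)
open import Data.Empty using (⊥-elim)
open import Function using (_∘_; id)
open import Function.Bundles using (_⤖_; mk↔ₛ′)
open import Function.Properties.Inverse using (↔⇒⤖)
open import Relation.Binary.PropositionalEquality
  using (_≡_; _≢_; refl; sym; trans; cong; subst; subst₂; module ≡-Reasoning)
open import Relation.Nullary using (yes; no)

Consecutive : ℕ → ℕ → Set
Consecutive a b = b ≡ suc a ⊎ a ≡ suc b

suc-coprime : ∀ n → Coprime (suc n) n
suc-coprime n {d} (d∣1+n , d∣n) = ∣1⇒≡1 (∣m+n∣m⇒∣n (subst (d ∣_) (+-comm 1 n) d∣1+n) d∣n)

consecutive⇒coprime : ∀ {a b} → Consecutive a b → Coprime a b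
consecutive⇒coprime {a} (inj₁ refl) = Coprime.sym (suc-coprime a)
consecutive⇒coprime {b = b} (inj₂ refl) = suc-coprime b

consecutive-+ˡ : ∀ c {a b} → Consecutive a b → Consecutive (c + a) (c + b)
consecutive-+ˡ c {a} (inj₁ e) = inj₁ (trans (cong (c +_) e) (+-suc c a))
consecutive-+ˡ c {b = b} (inj₂ e) = inj₂ (trans (cong (c +_) e) (+-suc c b))

module _ {V : Set} {N : ℕ} (Adj : V → V → Set) (f : V ⤖ Fin N) where

  nbhdGcdOne-one : ∀ {v u} → Adj v u → label f u ≡ 1 → NbhdGcdOne Adj f v
  nbhdGcdOne-one vu fu≡1 d d∣nbhd = ∣1⇒≡1 (subst (d ∣_) fu≡1 (d∣nbhd _ vu))

  nbhdGcdOne-coprime : ∀ {v u w} → Adj v u → Adj v w →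
                       Coprime (label f u) (label f w) → NbhdGcdOne Adj f v
  nbhdGcdOne-coprime vu vw coprime d d∣nbhd = coprime (d∣nbhd _ vu , d∣nbhd _ vw)

-- fold sends 0, 2, 4, … to 0, 1, 2, … and 1, 3, 5, … to n-1, n-2, n-3, …
fold : ∀ {n} → Fin n → Fin n
fold {suc n} zero = zero
fold {suc (suc n)} (suc zero) = fromℕ (suc n)
fold {suc (suc n)} (suc (suc j)) = suc (inject₁ (fold j))

unfold : ∀ {n} → Fin n → Fin n
unfold {suc n} zero = zero
unfold {suc (suc n)} (suc i) with view i
... | ‵fromℕ = suc zero
... | ‵inj₁ {i = j} _ = suc (suc (unfold j))

unfold-fold : ∀ {n} (j : Fin n) → unfold (fold j) ≡ j
unfold-fold {suc n} zero = refl
unfold-fold {suc (suc n)} (suc zero) rewrite view-fromℕ n = refl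
unfold-fold {suc (suc n)} (suc (suc j))
  rewrite view-inject₁ (fold j) = cong (λ i → suc (suc i)) (unfold-fold j)

fold-unfold : ∀ {n} (j : Fin n) → fold (unfold j) ≡ j
fold-unfold {suc n} zero = refl
fold-unfold {suc (suc n)} (suc i) with view i
... | ‵fromℕ = refl
... | ‵inj₁ {i = j} _ = cong (λ i → suc (inject₁ i)) (fold-unfold j)

fold-zero : ∀ {n} (j : Fin n) → toℕ j ≡ 0 → toℕ (fold j) ≡ 0
fold-zero {suc n} zero _ = refl

fold-step : ∀ {n} (j j' : Fin n) → toℕ j' ≡ 2 + toℕ j →
            Consecutive (toℕ (fold j)) (toℕ (fold j'))
fold-step {suc (suc n)} zero (suc (suc zero)) refl = inj₁ refl
fold-step {suc (suc n)} (suc zero) (suc (suc zero)) ()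
fold-step {suc (suc (suc (suc n)))} (suc zero) (suc (suc (suc zero))) refl =
  inj₂ (cong (3 +_) (sym (toℕ-inject₁ (fromℕ n))))
fold-step {suc (suc n)} (suc (suc j)) (suc (suc j')) e
  rewrite toℕ-inject₁ (fold j) | toℕ-inject₁ (fold j') =
  consecutive-+ˡ 1 (fold-step j j' (suc-injective (suc-injective e)))

m∸[1+n]≡1+m∸[2+n] : ∀ {m n} → 2 + n ≤ m → m ∸ suc n ≡ suc (m ∸ suc (suc n))
m∸[1+n]≡1+m∸[2+n] (s≤s (s≤s n≤m)) = +-∸-assoc 1 n≤m

opposite-pred : ∀ {n} {a b : Fin n} → toℕ b ≡ suc (toℕ a) →
                toℕ (opposite a) ≡ suc (toℕ (opposite b))
opposite-pred {n} {a} {b} b≡1+a = begin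
  toℕ (opposite a)               ≡⟨ opposite-prop a ⟩
  n ∸ suc (toℕ a)                ≡⟨ m∸[1+n]≡1+m∸[2+n] (subst (_≤ n) (cong suc b≡1+a) (toℕ<n b)) ⟩
  suc (n ∸ suc (suc (toℕ a)))    ≡⟨ cong (λ x → suc (n ∸ suc x)) b≡1+a ⟨
  suc (n ∸ suc (toℕ b))          ≡⟨ cong suc (opposite-prop b) ⟨
  suc (toℕ (opposite b))         ∎
  where open ≡-Reasoning

opposite-consecutive : ∀ {n} {a b : Fin n} → Consecutive (toℕ a) (toℕ b) →
                       Consecutive (toℕ (opposite a)) (toℕ (opposite b))
opposite-consecutive (inj₁ e) = inj₂ (opposite-pred e)
opposite-consecutive (inj₂ e) = inj₁ (opposite-pred e)

offset : ∀ {k} (len : Fin k → ℕ) → Fin k → ℕ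
offset len zero = 0
offset len (suc i) = len zero + offset (len ∘ suc) i

encode : ∀ {k} (len : Fin k → ℕ) → Σ (Fin k) (Fin ∘ len) → Fin (sum (tabulate len))
encode len (zero , j) = j ↑ˡ _
encode len (suc i , j) = len zero ↑ʳ encode (len ∘ suc) (i , j)

decode : ∀ {k} (len : Fin k → ℕ) → Fin (sum (tabulate len)) → Σ (Fin k) (Fin ∘ len)
decode {suc k} len x with splitAt (len zero) x
... | inj₁ j = zero , j
... | inj₂ y = map suc id (decode (len ∘ suc) y)

decode-encode : ∀ {k} (len : Fin k → ℕ) p → decode len (encode len p) ≡ p
decode-encode len (zero , j) rewrite splitAt-↑ˡ (len zero) j (sum (tabulate (len ∘ suc))) = refl
decode-encode len (suc i , j)
  rewrite splitAt-↑ʳ (len zero) (sum (tabulate (len ∘ suc))) (encode (len ∘ suc) (i , j))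
        | decode-encode (len ∘ suc) (i , j) = refl

encode-decode : ∀ {k} (len : Fin k → ℕ) x → encode len (decode len x) ≡ x
encode-decode {suc k} len x with splitAt (len zero) x in eq
... | inj₁ j = splitAt⁻¹-↑ˡ eq
... | inj₂ y = trans (cong (len zero ↑ʳ_) (encode-decode (len ∘ suc) y)) (splitAt⁻¹-↑ʳ eq)

toℕ-encode : ∀ {k} (len : Fin k → ℕ) i (j : Fin (len i)) →
             toℕ (encode len (i , j)) ≡ offset len i + toℕ j
toℕ-encode len zero j = toℕ-↑ˡ j _
toℕ-encode len (suc i) j = begin
  toℕ (len zero ↑ʳ encode (len ∘ suc) (i , j))   ≡⟨ toℕ-↑ʳ (len zero) _ ⟩
  len zero + toℕ (encode (len ∘ suc) (i , j))    ≡⟨ cong (len zero +_) (toℕ-encode (len ∘ suc) i j) ⟩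
  len zero + (offset (len ∘ suc) i + toℕ j)      ≡⟨ +-assoc (len zero) _ _ ⟨
  offset len (suc i) + toℕ j                     ∎
  where open ≡-Reasoning

legOrder : ∀ {k n} → Fin k → Fin n → Fin n
legOrder zero = opposite ∘ fold
legOrder (suc _) = fold

legOrder⁻¹ : ∀ {k n} → Fin k → Fin n → Fin n
legOrder⁻¹ zero = unfold ∘ opposite
legOrder⁻¹ (suc _) = unfold

legOrder⁻¹-legOrder : ∀ {k n} (i : Fin k) (j : Fin n) → legOrder⁻¹ i (legOrder i j) ≡ j
legOrder⁻¹-legOrder zero j = trans (cong unfold (opposite-involutive (fold j))) (unfold-fold j)
legOrder⁻¹-legOrder (suc _) j = unfold-fold j

legOrder-legOrder⁻¹ : ∀ {k n} (i : Fin k) (j : Fin n) → legOrder i (legOrder⁻¹ i j) ≡ j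
legOrder-legOrder⁻¹ zero j = trans (cong opposite (fold-unfold (opposite j))) (opposite-involutive j)
legOrder-legOrder⁻¹ (suc _) j = fold-unfold j

legOrder-step : ∀ {k n} (i : Fin k) {j j' : Fin n} → toℕ j' ≡ 2 + toℕ j →
                Consecutive (toℕ (legOrder i j)) (toℕ (legOrder i j'))
legOrder-step zero {j} {j'} e = opposite-consecutive (fold-step j j' e)
legOrder-step (suc _) {j} {j'} e = fold-step j j' e

predecessor : ∀ {n} (j : Fin n) → toℕ j ≢ 0 → Σ (Fin n) λ j' → toℕ j ≡ suc (toℕ j')
predecessor zero j≢0 = ⊥-elim (j≢0 refl)
predecessor (suc j) _ = inject₁ j , cong suc (sym (toℕ-inject₁ j))

DegGt1⇒successor : ∀ {k len i} {j : Fin (len i)} → DegGt1 (SpiderAdj k len) (node i j) →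
                   toℕ j ≢ 0 → Σ (Fin (len i)) λ j' → toℕ j' ≡ suc (toℕ j)
DegGt1⇒successor (_ , _ , _ , next _ _ j' e , _) _ = j' , e
DegGt1⇒successor (_ , _ , _ , _ , next _ _ j' e) _ = j' , e
DegGt1⇒successor (_ , _ , _ , l→c _ _ e , _) j≢0 = ⊥-elim (j≢0 e)
DegGt1⇒successor (_ , _ , _ , _ , l→c _ _ e) j≢0 = ⊥-elim (j≢0 e)
DegGt1⇒successor (_ , _ , u≢w , prev _ _ a a≡ , prev _ _ b b≡) _ =
  ⊥-elim (u≢w (cong (node _) (toℕ-injective (suc-injective (trans (sym a≡) b≡)))))

module SpiderLabeling {k : ℕ} (len : Fin k → ℕ) where

  Adj = SpiderAdj k len

  toLabel : SpiderV k len → Fin (spiderSize k len)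
  toLabel centre = zero
  toLabel (node i j) = suc (encode len (i , legOrder i j))

  fromLabel : Fin (spiderSize k len) → SpiderV k len
  fromLabel zero = centre
  fromLabel (suc x) = node i (legOrder⁻¹ i j)
    where open Σ (decode len x) renaming (proj₁ to i; proj₂ to j)

  toLabel-fromLabel : ∀ x → toLabel (fromLabel x) ≡ x
  toLabel-fromLabel zero = refl
  toLabel-fromLabel (suc x) = cong suc (trans
    (cong (λ j → encode len (i , j)) (legOrder-legOrder⁻¹ i j))
    (encode-decode len x))
    where open Σ (decode len x) renaming (proj₁ to i; proj₂ to j)

  fromLabel-toLabel : ∀ v → fromLabel (toLabel v) ≡ v
  fromLabel-toLabel centre = refl
  fromLabel-toLabel (node i j)
    rewrite decode-encode len (i , legOrder i j) = cong (node i) (legOrder⁻¹-legOrder i j)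

  labeling : SpiderV k len ⤖ Fin (spiderSize k len)
  labeling = ↔⇒⤖ (mk↔ₛ′ toLabel fromLabel toLabel-fromLabel fromLabel-toLabel)

  label-node : ∀ i j → label labeling (node i j) ≡ 2 + (offset len i + toℕ (legOrder i j))
  label-node i j = cong (2 +_) (toℕ-encode len i (legOrder i j))

  consecutive-labels : ∀ i {j j'} → toℕ j' ≡ 2 + toℕ j →
                       Consecutive (label labeling (node i j)) (label labeling (node i j'))
  consecutive-labels i {j} {j'} e = subst₂ Consecutive (sym (label-node i j)) (sym (label-node i j'))
    (consecutive-+ˡ (2 + offset len i) (legOrder-step i e))

  node-nbhdGcdOne : ∀ {i j} → DegGt1 Adj (node i j) → NbhdGcdOne Adj labeling (node i j)
  node-nbhdGcdOne {i} {j} deg with toℕ j ≟ 0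
  ... | yes j≡0 = nbhdGcdOne-one Adj labeling (l→c i j j≡0) refl
  ... | no j≢0 with predecessor j j≢0 | DegGt1⇒successor deg j≢0
  ...   | j₋ , j≡1+j₋ | j₊ , j₊≡1+j = nbhdGcdOne-coprime Adj labeling (prev i j j₋ j≡1+j₋) (next i j j₊ j₊≡1+j)
          (consecutive⇒coprime (consecutive-labels i (trans j₊≡1+j (cong suc j≡1+j₋))))

module _ {k : ℕ} (len : Fin (suc (suc k)) → ℕ) where
  open SpiderLabeling len

  label-first-of-leg₀ : (z : Fin (len zero)) → toℕ z ≡ 0 → label labeling (node zero z) ≡ suc (len zero)
  label-first-of-leg₀ z z≡0 = begin
    label labeling (node zero z)           ≡⟨ label-node zero z ⟩
    2 + toℕ (opposite (fold z))            ≡⟨ cong (2 +_) (opposite-prop (fold z)) ⟩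
    2 + (len zero ∸ suc (toℕ (fold z)))    ≡⟨ cong (λ x → 2 + (len zero ∸ suc x)) (fold-zero z z≡0) ⟩
    2 + (len zero ∸ 1)                     ≡⟨ cong suc (m+[n∸m]≡n (subst (λ x → suc x ≤ len zero) z≡0 (toℕ<n z))) ⟩
    suc (len zero)                         ∎
    where open ≡-Reasoning

  label-first-of-leg₁ : (z : Fin (len (suc zero))) → toℕ z ≡ 0 →
                        label labeling (node (suc zero) z) ≡ 2 + len zero
  label-first-of-leg₁ z z≡0 = begin
    label labeling (node (suc zero) z)     ≡⟨ label-node (suc zero) z ⟩
    2 + (len zero + 0 + toℕ (fold z))      ≡⟨ cong (λ x → 2 + (len zero + 0 + x)) (fold-zero z z≡0) ⟩
    2 + (len zero + 0 + 0)                 ≡⟨ cong (2 +_) (trans (+-identityʳ _) (+-identityʳ _)) ⟩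
    2 + len zero                           ∎
    where open ≡-Reasoning

  centre-nbhdGcdOne : 1 ≤ len zero → 1 ≤ len (suc zero) → NbhdGcdOne Adj labeling centre
  centre-nbhdGcdOne 0<len₀ 0<len₁ = nbhdGcdOne-coprime Adj labeling
    (c→l zero z₀ z₀≡0) (c→l (suc zero) z₁ z₁≡0)
    (consecutive⇒coprime (subst₂ Consecutive
      (sym (label-first-of-leg₀ z₀ z₀≡0)) (sym (label-first-of-leg₁ z₁ z₁≡0)) (inj₁ refl)))
    where
    z₀ = fromℕ< 0<len₀
    z₀≡0 = toℕ-fromℕ< 0<len₀
    z₁ = fromℕ< 0<len₁
    z₁≡0 = toℕ-fromℕ< 0<len₁

  spider-neighborhoodPrimeLabeling : 1 ≤ len zero → 1 ≤ len (suc zero) →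
                                     NeighborhoodPrimeLabeling (spiderSize _ len) Adj labeling
  spider-neighborhoodPrimeLabeling 0<len₀ 0<len₁ centre _ = centre-nbhdGcdOne 0<len₀ 0<len₁
  spider-neighborhoodPrimeLabeling _ _ (node i j) deg = node-nbhdGcdOne deg

mainTheorem12 : (k : ℕ) → 3 ≤ k → (len : Fin k → ℕ) → (∀ i → 1 ≤ len i) →
    NeighborhoodPrime (SpiderV k len) (spiderSize k len) (SpiderAdj k len)
mainTheorem12 _ (s≤s (s≤s (s≤s _))) len 0<len =
  SpiderLabeling.labeling len , spider-neighborhoodPrimeLabeling len (0<len zero) (0<len (suc zero))
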